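{- Let $\mu_1$ and $\mu_2$ each be either a nonempty finite sequence of positive integers or the sequence $0,0$. Then $$N[\mu_1,1,1,\mu_2]-N[\mu_1,2,\mu_2]=N[\mu_1^-]\,N[{}^-\mu_2].$$
   Context: For $a_i\in\mathbb Z_{\ge0}$ with $a_n\neq0$, $[a_1,\dots,a_n]=a_1+\cfrac{1}{a_2+\cfrac{1}{\ddots+\cfrac1{a_n}}}$, and $N[a_1,\dots,a_n]$ denotes the numerator of this rational number in lowest terms. Conventions: $N[\,]=1$ (empty sequence), and $N[a_1,\dots,a_n,0,0]:=N[0,0,a_n,\dots,a_1]$. Concatenation of sequences is written with commas. For a sequence $\mu=a_1,\dots,a_n$ (allowing $\mu=0,0$): $N[\mu]=N[a_1,\dots,a_n]$; $N[\mu^-]=N[a_1,\dots,a_{n-1}]$ and $N[{}^-\mu]=N[a_2,\dots,a_n]$ if $n>1$, while both equal $N[\,]=1$ if $n=1$; $N[{}^-\mu^-]=N[a_2,\dots,a_{n-1}]$ if $n>2$ and $=1$ if $n=2$. In particular for $\mu=0,0$ one has $N[\mu^-]=N[{}^-\mu]=N[0]=0$. -}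

module Defs where

open import Data.Nat using (ℕ; zero; suc; _<_)
open import Data.Integer using (ℤ; ∣_∣; +_)
open import Data.List using (List; []; _∷_; _++_; reverse)
open import Data.List.Relation.Unary.All using (All)
open import Data.Rational using (ℚ; 0ℚ; _+_; 1/_; ↥_; ≢-nonZero)
import Data.Rational as ℚ
open import Data.Rational.Properties using (_≟_)
open import Data.Sum using (_⊎_)
open import Data.Product using (_×_)
open import Relation.Nullary using (yes; no; ¬_)
open import Relation.Binary.PropositionalEquality using (_≡_)

-- total reciprocal on ℚ; 1/0 := 0 (only used as junk)
inv : ℚ → ℚ
inv q with q ≟ 0ℚ
... | yes _  = 0ℚ
... | no q≢0 = 1/_ q {{≢-nonZero q≢0}}

cf : List ℕ → ℚ
cf []           = 0ℚ
cf (a ∷ [])     = (+ a) ℚ./ 1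
cf (a ∷ b ∷ as) = ((+ a) ℚ./ 1) + inv (cf (b ∷ as))

-- numerator in lowest terms (ℚ is kept normalised in the stdlib)
Ncf : List ℕ → ℕ
Ncf l = ∣ ↥ cf l ∣

-- N[ ] = 1 ;  N[a₁,…,aₙ,0,0] := N[0,0,aₙ,…,a₁] ;  otherwise the numerator of [a₁,…,aₙ]
N : List ℕ → ℕ
N [] = 1
N l@(_ ∷ _) with reverse l
... | 0 ∷ 0 ∷ r = Ncf (0 ∷ 0 ∷ r)
... | _         = Ncf l

-- μ⁻ : drop the last entry ;  ⁻μ : drop the first entry  (singleton ↦ empty)
dropLast : List ℕ → List ℕ
dropLast []           = []
dropLast (a ∷ [])     = []
dropLast (a ∷ b ∷ as) = a ∷ dropLast (b ∷ as)

dropFirst : List ℕ → List ℕ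
dropFirst []       = []
dropFirst (_ ∷ as) = as

Admissible : List ℕ → Set
Admissible μ = (¬ (μ ≡ []) × All (0 <_) μ) ⊎ (μ ≡ 0 ∷ 0 ∷ [])

module Submission where

-- Proof idea.  Write K for the continuant: K [] = 1, K [a] = a and
-- K (a , b , r) = a K (b , r) + K r.  Everything reduces to two facts:
--
--  * the numerator of a continued fraction with positive entries is its
--    continuant: [l] = K l / K (⁻l) with K l and K (⁻l) coprime, hence
--    N[l] = K l;  moreover the prefix 0,0 does not change [l];
--  * Euler's splitting rule K (p , q) = K p K q + K (p⁻) K (⁻q), which with
--    K (1,1,q) = K (2,q) and K (1,q) = K q + K (⁻q) gives
--    K (p,1,1,q) = K (p,2,q) + K (p⁻) K (⁻q).
--
-- When μ₁ and μ₂ are positive the theorem is the second identity read through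
-- the first.  When μ₁ or μ₂ is 0,0 the convention for N turns both numerators
-- on the left into the continuant of a list starting with 1,1 resp. 2 (the
-- rest being positive), so they agree, while the right-hand side contains the
-- factor N[0] = 0.

open import Defs
open import Data.List using (List; []; _∷_; _++_; reverse)
open import Data.Nat using (ℕ; zero; suc; _<_; s≤s; z≤n)
open import Data.Integer using (+_; _-_; _*_)
import Data.Nat as ℕ
import Data.Nat.Properties as ℕP
import Data.Integer as ℤ
import Data.Integer.Properties as ℤP
open import Data.Nat.Coprimality using (Coprime; coprime-+; 1-coprimeTo)
import Data.Nat.Coprimality as Coprime
open import Data.Rational using (mkℚ; 0ℚ; ↥_)
import Data.Rational as ℚ
import Data.Rational.Properties as ℚP
open import Data.List.Relation.Unary.All using (All; []; _∷_; tail)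
import Data.List.Relation.Unary.All.Properties as AllP
import Data.List.Properties as ListP
open import Data.Product using (Σ; _,_)
open import Data.Sum using (inj₁; inj₂)
open import Data.Empty using (⊥-elim)
open import Relation.Binary.PropositionalEquality
  using (_≡_; refl; sym; trans; cong; cong₂; subst; module ≡-Reasoning)
open import Data.Nat.Solver using (module +-*-Solver)
open +-*-Solver using (solve; _:=_; _:+_; _:*_; con)

K : List ℕ → ℕ
K []          = 1
K (a ∷ [])    = a
K (a ∷ b ∷ r) = a ℕ.* K (b ∷ r) ℕ.+ K r

K-split : ∀ a p c q →
  K ((a ∷ p) ++ c ∷ q) ≡ K (a ∷ p) ℕ.* K (c ∷ q) ℕ.+ K (dropLast (a ∷ p)) ℕ.* K q
K-split a [] c q = cong (a ℕ.* K (c ∷ q) ℕ.+_) (sym (ℕP.*-identityˡ (K q)))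
K-split a (b ∷ []) c q =
  solve 4 (λ a b x y → a :* (b :* x :+ y) :+ x := (a :* b :+ con 1) :* x :+ a :* y)
    refl a b (K (c ∷ q)) (K q)
K-split a (b ∷ b′ ∷ p) c q = begin
    a ℕ.* K ((b ∷ b′ ∷ p) ++ c ∷ q) ℕ.+ K ((b′ ∷ p) ++ c ∷ q)
  ≡⟨ cong₂ (λ u v → a ℕ.* u ℕ.+ v) (K-split b (b′ ∷ p) c q) (K-split b′ p c q) ⟩
    a ℕ.* (X ℕ.* Y ℕ.+ U ℕ.* Z) ℕ.+ (V ℕ.* Y ℕ.+ W ℕ.* Z)
  ≡⟨ solve 7 (λ a X Y Z U V W →
       a :* (X :* Y :+ U :* Z) :+ (V :* Y :+ W :* Z) := (a :* X :+ V) :* Y :+ (a :* U :+ W) :* Z)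
       refl a X Y Z U V W ⟩
    (a ℕ.* X ℕ.+ V) ℕ.* Y ℕ.+ (a ℕ.* U ℕ.+ W) ℕ.* Z
  ∎
  where
    open ≡-Reasoning
    X = K (b ∷ b′ ∷ p)
    V = K (b′ ∷ p)
    U = K (dropLast (b ∷ b′ ∷ p))
    W = K (dropLast (b′ ∷ p))
    Y = K (c ∷ q)
    Z = K q

K-11≡2 : ∀ q → K (1 ∷ 1 ∷ q) ≡ K (2 ∷ q)
K-11≡2 []      = refl
K-11≡2 (c ∷ q) =
  solve 2 (λ x y → con 1 :* (con 1 :* x :+ y) :+ x := con 2 :* x :+ y) refl (K (c ∷ q)) (K q)

-- Continuant form of the theorem: K(p,1,1,q) = K(p,2,q) + K(p⁻) K(⁻q).
-- Split both sides after p; the first terms agree by K-11≡2, and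
-- K(1,q) exceeds K q by K(⁻q).
K-insert-11 : ∀ a p c q →
  K ((a ∷ p) ++ 1 ∷ 1 ∷ c ∷ q)
    ≡ K ((a ∷ p) ++ 2 ∷ c ∷ q) ℕ.+ K (dropLast (a ∷ p)) ℕ.* K q
K-insert-11 a p c q = begin
    K ((a ∷ p) ++ 1 ∷ 1 ∷ c ∷ q)
  ≡⟨ K-split a p 1 (1 ∷ c ∷ q) ⟩
    Kp ℕ.* K (1 ∷ 1 ∷ c ∷ q) ℕ.+ Kp⁻ ℕ.* (1 ℕ.* K (c ∷ q) ℕ.+ K q)
  ≡⟨ cong (λ u → Kp ℕ.* u ℕ.+ Kp⁻ ℕ.* (1 ℕ.* K (c ∷ q) ℕ.+ K q)) (K-11≡2 (c ∷ q)) ⟩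
    Kp ℕ.* K (2 ∷ c ∷ q) ℕ.+ Kp⁻ ℕ.* (1 ℕ.* K (c ∷ q) ℕ.+ K q)
  ≡⟨ solve 5 (λ P x P⁻ y z → P :* x :+ P⁻ :* (con 1 :* y :+ z) := (P :* x :+ P⁻ :* y) :+ P⁻ :* z)
       refl Kp (K (2 ∷ c ∷ q)) Kp⁻ (K (c ∷ q)) (K q) ⟩
    (Kp ℕ.* K (2 ∷ c ∷ q) ℕ.+ Kp⁻ ℕ.* K (c ∷ q)) ℕ.+ Kp⁻ ℕ.* K q
  ≡⟨ cong (ℕ._+ Kp⁻ ℕ.* K q) (sym (K-split a p 2 (c ∷ q))) ⟩
    K ((a ∷ p) ++ 2 ∷ c ∷ q) ℕ.+ Kp⁻ ℕ.* K q
  ∎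
  where
    open ≡-Reasoning
    Kp  = K (a ∷ p)
    Kp⁻ = K (dropLast (a ∷ p))

Pos : List ℕ → Set
Pos = All (0 <_)

Pos-dropLast : ∀ {l} → Pos l → Pos (dropLast l)
Pos-dropLast {[]}        _          = []
Pos-dropLast {a ∷ []}    _          = []
Pos-dropLast {a ∷ b ∷ r} (pa ∷ pbr) = pa ∷ Pos-dropLast pbr

Pos-reverse : ∀ {l} → Pos l → Pos (reverse l)
Pos-reverse {[]}     _          = []
Pos-reverse {x ∷ xs} (px ∷ pxs) rewrite ListP.unfold-reverse x xs =
  AllP.++⁺ (Pos-reverse pxs) (px ∷ [])

last-positive : ∀ a r → Pos (a ∷ r) → Σ ℕ λ y → Σ (List ℕ) λ r′ → reverse (a ∷ r) ≡ suc y ∷ r′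
last-positive (suc y) []      _         = y , [] , refl
last-positive a       (b ∷ r) (_ ∷ pbr) with last-positive b r pbr
... | y , r′ , e = y , r′ ++ a ∷ [] ,
  trans (ListP.unfold-reverse a (b ∷ r)) (cong (_++ a ∷ []) e)

coprime-+-multiple : ∀ a {m s} → Coprime s m → Coprime (a ℕ.* m ℕ.+ s) m
coprime-+-multiple zero    c = c
coprime-+-multiple (suc a) {m} {s} c =
  subst (λ x → Coprime x m) (sym (ℕP.+-assoc m (a ℕ.* m) s)) (coprime-+ (coprime-+-multiple a c))

numerator-sum : ∀ a x y → + a ℤ.* + x ℤ.+ + y ℤ.* + 1 ≡ + (a ℕ.* x ℕ.+ y)
numerator-sum a x y = begin
    + a ℤ.* + x ℤ.+ + y ℤ.* + 1
  ≡⟨ cong₂ ℤ._+_ (sym (ℤP.pos-* a x)) (ℤP.*-identityʳ (+ y)) ⟩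
    + (a ℕ.* x) ℤ.+ + y
  ≡⟨ sym (ℤP.pos-+ (a ℕ.* x) y) ⟩
    + (a ℕ.* x ℕ.+ y)
  ∎ where open ≡-Reasoning

record ContinuantFraction (l : List ℕ) : Set where
  field
    num-1 den-1 : ℕ
    K≡num       : K l ≡ suc num-1
    K-tail≡den  : K (dropFirst l) ≡ suc den-1
    coprime     : Coprime (suc num-1) (suc den-1)
    cf≡         : cf l ≡ mkℚ (+ suc num-1) den-1 coprime

-- The recursion [a,b,r] = a + 1/[b,r] turns  n/d  into  (a·n + d)/n,
-- which stays reduced by coprime-+-multiple.
continuant-fraction-step : ∀ a {b r} → ContinuantFraction (b ∷ r) → ContinuantFraction (a ∷ b ∷ r)
continuant-fraction-step a {b} {r} F = record
  { num-1 = a ℕ.* suc n ℕ.+ d ; den-1 = n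
  ; K≡num = trans (cong₂ (λ u v → a ℕ.* u ℕ.+ v) K≡num K-tail≡den) numerator-suc
  ; K-tail≡den = K≡num ; coprime = coprime′ ; cf≡ = cf≡′ }
  where
    open ContinuantFraction F renaming (num-1 to n; den-1 to d)
    open ≡-Reasoning
    numerator-suc : a ℕ.* suc n ℕ.+ suc d ≡ suc (a ℕ.* suc n ℕ.+ d)
    numerator-suc = ℕP.+-suc (a ℕ.* suc n) d
    coprime′ : Coprime (suc (a ℕ.* suc n ℕ.+ d)) (suc n)
    coprime′ = subst (λ x → Coprime x (suc n)) numerator-suc
                 (coprime-+-multiple a (Coprime.sym coprime))
    cf≡′ : cf (a ∷ b ∷ r) ≡ mkℚ (+ suc (a ℕ.* suc n ℕ.+ d)) n coprime′
    cf≡′ = begin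
        (+ a) ℚ./ 1 ℚ.+ inv (cf (b ∷ r))
      ≡⟨ cong₂ ℚ._+_ (ℚP.normalize-coprime (Coprime.sym (1-coprimeTo a))) (cong inv cf≡) ⟩
        mkℚ (+ a) 0 (Coprime.sym (1-coprimeTo a)) ℚ.+ mkℚ (+ suc d) n (Coprime.sym coprime)
      ≡⟨ ℚP./-cong (numerator-sum a (suc n) (suc d)) (ℕP.*-identityˡ (suc n)) ⟩
        (+ (a ℕ.* suc n ℕ.+ suc d)) ℚ./ suc n
      ≡⟨ cong (λ x → (+ x) ℚ./ suc n) numerator-suc ⟩
        (+ suc (a ℕ.* suc n ℕ.+ d)) ℚ./ suc n
      ≡⟨ ℚP.normalize-coprime coprime′ ⟩
        mkℚ (+ suc (a ℕ.* suc n ℕ.+ d)) n coprime′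
      ∎

continuant-fraction : ∀ a r → Pos (a ∷ r) → ContinuantFraction (a ∷ r)
continuant-fraction (suc a) [] _ = record
  { num-1 = a ; den-1 = 0 ; K≡num = refl ; K-tail≡den = refl
  ; coprime = Coprime.sym (1-coprimeTo _)
  ; cf≡ = ℚP.normalize-coprime (Coprime.sym (1-coprimeTo _)) }
continuant-fraction a (b ∷ r) (_ ∷ pbr) = continuant-fraction-step a (continuant-fraction b r pbr)

Ncf-positive : ∀ a r → Pos (a ∷ r) → Ncf (a ∷ r) ≡ K (a ∷ r)
Ncf-positive a r pos = trans (cong (λ q → ℤ.∣ ↥ q ∣) cf≡) (sym K≡num)
  where open ContinuantFraction (continuant-fraction a r pos)

-- ... and a leading 0,0 does not change it, as 0 + 1/(0 + 1/x) = x.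
Ncf-skip-00 : ∀ a r → Pos (a ∷ r) → Ncf (0 ∷ 0 ∷ a ∷ r) ≡ Ncf (a ∷ r)
Ncf-skip-00 a r pos = cong (λ q → ℤ.∣ ↥ q ∣) (begin
    0ℚ ℚ.+ inv (0ℚ ℚ.+ inv (cf (a ∷ r)))
  ≡⟨ ℚP.+-identityˡ _ ⟩
    inv (0ℚ ℚ.+ inv (cf (a ∷ r)))
  ≡⟨ cong (λ q → inv (0ℚ ℚ.+ inv q)) cf≡ ⟩
    inv (0ℚ ℚ.+ mkℚ (+ suc den-1) num-1 (Coprime.sym coprime))
  ≡⟨ cong inv (ℚP.+-identityˡ (mkℚ (+ suc den-1) num-1 (Coprime.sym coprime))) ⟩
    mkℚ (+ suc num-1) den-1 coprime
  ≡⟨ sym cf≡ ⟩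
    cf (a ∷ r)
  ∎)
  where
    open ContinuantFraction (continuant-fraction a r pos)
    open ≡-Reasoning

N-unpadded : ∀ l {y r} → reverse l ≡ suc y ∷ r → N l ≡ Ncf l
N-unpadded []       ()
N-unpadded (x ∷ xs) e with reverse (x ∷ xs) | e
... | ._ | refl = refl

N-padded : ∀ l {r} → reverse l ≡ 0 ∷ 0 ∷ r → N l ≡ Ncf (0 ∷ 0 ∷ r)
N-padded []       ()
N-padded (x ∷ xs) e with reverse (x ∷ xs) | e
... | ._ | refl = refl

N-positive : ∀ l → Pos l → N l ≡ K l
N-positive []      _   = refl
N-positive (a ∷ r) pos with last-positive a r pos
... | _ , _ , e = trans (N-unpadded (a ∷ r) e) (Ncf-positive a r pos)

N-left-padded : ∀ a r → Pos (a ∷ r) → N (0 ∷ 0 ∷ a ∷ r) ≡ K (a ∷ r)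
N-left-padded a r pos with last-positive a r pos
... | _ , _ , e = begin
    N (0 ∷ 0 ∷ a ∷ r)
  ≡⟨ N-unpadded (0 ∷ 0 ∷ a ∷ r)
       (trans (ListP.reverse-++ (0 ∷ 0 ∷ []) (a ∷ r)) (cong (_++ 0 ∷ 0 ∷ []) e)) ⟩
    Ncf (0 ∷ 0 ∷ a ∷ r)
  ≡⟨ Ncf-skip-00 a r pos ⟩
    Ncf (a ∷ r)
  ≡⟨ Ncf-positive a r pos ⟩
    K (a ∷ r)
  ∎ where open ≡-Reasoning

N-right-padded : ∀ l a r → reverse l ≡ 0 ∷ 0 ∷ a ∷ r → Pos (a ∷ r) → N l ≡ K (a ∷ r)
N-right-padded l a r e pos =
  trans (N-padded l e) (trans (Ncf-skip-00 a r pos) (Ncf-positive a r pos))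

-- In the degenerate cases the two numerators on the left coincide:
-- by the 0,0 convention both become K(1,1,ν) resp. K(2,ν) for a positive ν.
degenerate-left : ∀ c q → Pos (c ∷ q) → N (0 ∷ 0 ∷ 1 ∷ 1 ∷ c ∷ q) ≡ N (0 ∷ 0 ∷ 2 ∷ c ∷ q)
degenerate-left c q pos = begin
    N (0 ∷ 0 ∷ 1 ∷ 1 ∷ c ∷ q)  ≡⟨ N-left-padded 1 (1 ∷ c ∷ q) (s≤s z≤n ∷ s≤s z≤n ∷ pos) ⟩
    K (1 ∷ 1 ∷ c ∷ q)          ≡⟨ K-11≡2 (c ∷ q) ⟩
    K (2 ∷ c ∷ q)              ≡⟨ sym (N-left-padded 2 (c ∷ q) (s≤s z≤n ∷ pos)) ⟩
    N (0 ∷ 0 ∷ 2 ∷ c ∷ q)      ∎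
  where open ≡-Reasoning

degenerate-right : ∀ μ → Pos μ → N (μ ++ 1 ∷ 1 ∷ 0 ∷ 0 ∷ []) ≡ N (μ ++ 2 ∷ 0 ∷ 0 ∷ [])
degenerate-right μ pos = begin
    N (μ ++ 1 ∷ 1 ∷ 0 ∷ 0 ∷ [])
  ≡⟨ N-right-padded (μ ++ 1 ∷ 1 ∷ 0 ∷ 0 ∷ []) 1 (1 ∷ reverse μ) (ListP.reverse-++ μ (1 ∷ 1 ∷ 0 ∷ 0 ∷ []))
       (s≤s z≤n ∷ s≤s z≤n ∷ Pos-reverse pos) ⟩
    K (1 ∷ 1 ∷ reverse μ)
  ≡⟨ K-11≡2 (reverse μ) ⟩
    K (2 ∷ reverse μ)
  ≡⟨ sym (N-right-padded (μ ++ 2 ∷ 0 ∷ 0 ∷ []) 2 (reverse μ) (ListP.reverse-++ μ (2 ∷ 0 ∷ 0 ∷ []))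
       (s≤s z≤n ∷ Pos-reverse pos)) ⟩
    N (μ ++ 2 ∷ 0 ∷ 0 ∷ [])
  ∎ where open ≡-Reasoning

sum-minus : ∀ x y z → (+ (x ℕ.+ y ℕ.* z)) - (+ x) ≡ (+ y) * (+ z)
sum-minus x y z = begin
    (+ (x ℕ.+ y ℕ.* z)) - (+ x)  ≡⟨ ℤP.m-n≡m⊖n (x ℕ.+ y ℕ.* z) x ⟩
    (x ℕ.+ y ℕ.* z) ℤ.⊖ x        ≡⟨ ℤP.⊖-≥ (ℕP.m≤m+n x (y ℕ.* z)) ⟩
    + (x ℕ.+ y ℕ.* z ℕ.∸ x)      ≡⟨ cong +_ (ℕP.m+n∸m≡n x (y ℕ.* z)) ⟩
    + (y ℕ.* z)                  ≡⟨ ℤP.pos-* y z ⟩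
    (+ y) * (+ z)                ∎
  where open ≡-Reasoning

equal-minus : ∀ {x y} → x ≡ y → (+ x) - (+ y) ≡ + 0
equal-minus {x} refl = ℤP.+-inverseʳ (+ x)

positive-case : ∀ a p c q → Pos (a ∷ p) → Pos (c ∷ q) →
  (+ N ((a ∷ p) ++ 1 ∷ 1 ∷ c ∷ q)) - (+ N ((a ∷ p) ++ 2 ∷ c ∷ q))
    ≡ (+ N (dropLast (a ∷ p))) * (+ N q)
positive-case a p c q pos₁ pos₂ = begin
    (+ N ((a ∷ p) ++ 1 ∷ 1 ∷ c ∷ q)) - (+ N ((a ∷ p) ++ 2 ∷ c ∷ q))
  ≡⟨ cong₂ (λ u v → (+ u) - (+ v))
       (N-positive _ (AllP.++⁺ pos₁ (s≤s z≤n ∷ s≤s z≤n ∷ pos₂)))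
       (N-positive _ (AllP.++⁺ pos₁ (s≤s z≤n ∷ pos₂))) ⟩
    (+ K ((a ∷ p) ++ 1 ∷ 1 ∷ c ∷ q)) - (+ K ((a ∷ p) ++ 2 ∷ c ∷ q))
  ≡⟨ cong (λ u → (+ u) - (+ K ((a ∷ p) ++ 2 ∷ c ∷ q))) (K-insert-11 a p c q) ⟩
    (+ (K ((a ∷ p) ++ 2 ∷ c ∷ q) ℕ.+ K (dropLast (a ∷ p)) ℕ.* K q)) - (+ K ((a ∷ p) ++ 2 ∷ c ∷ q))
  ≡⟨ sum-minus (K ((a ∷ p) ++ 2 ∷ c ∷ q)) (K (dropLast (a ∷ p))) (K q) ⟩
    (+ K (dropLast (a ∷ p))) * (+ K q)
  ≡⟨ sym (cong₂ (λ u v → (+ u) * (+ v))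
       (N-positive _ (Pos-dropLast pos₁)) (N-positive q (tail pos₂))) ⟩
    (+ N (dropLast (a ∷ p))) * (+ N q)
  ∎ where open ≡-Reasoning

-- Lemma 3.4.  In the degenerate cases the right-hand side vanishes because
-- N[⁻(0,0)] = N[(0,0)⁻] = N[0] = 0.
lemma3p4 : (μ₁ μ₂ : List ℕ) → Admissible μ₁ → Admissible μ₂ →
  (+ N (μ₁ ++ 1 ∷ 1 ∷ μ₂)) - (+ N (μ₁ ++ 2 ∷ μ₂))
    ≡ (+ N (dropLast μ₁)) * (+ N (dropFirst μ₂))
lemma3p4 []      _       (inj₁ (μ₁≢[] , _)) _                  = ⊥-elim (μ₁≢[] refl)
lemma3p4 _       []      _                  (inj₁ (μ₂≢[] , _)) = ⊥-elim (μ₂≢[] refl)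
lemma3p4 (a ∷ p) (c ∷ q) (inj₁ (_ , pos₁))  (inj₁ (_ , pos₂))  = positive-case a p c q pos₁ pos₂
lemma3p4 μ₁ ._ (inj₁ (_ , pos₁)) (inj₂ refl) =
  trans (equal-minus (degenerate-right μ₁ pos₁)) (sym (ℤP.*-zeroʳ (+ N (dropLast μ₁))))
lemma3p4 ._ (c ∷ q) (inj₂ refl) (inj₁ (_ , pos₂)) = equal-minus (degenerate-left c q pos₂)
lemma3p4 ._ ._      (inj₂ refl) (inj₂ refl)       = refl
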